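{- Let \(\Gamma\) be a set of atomic sentences over a signature \(\Delta\) and let \((W^{\Gamma}, M^{\Gamma})\) be a reachable initial model of \(\Gamma\). Then for every atomic sentence or action relation \(\rho\) over \(\Delta\): \(\Gamma \models \rho\) if and only if \((W^{\Gamma}, M^{\Gamma}) \models \rho\).
   Context: Signatures: \(\Delta = (\Sigma^{n}, \Sigma^{r} \subseteq \Sigma)\), where \(\Sigma^{n} = (\{\star\}, F^{n}, P^{n})\) is a one-sorted first-order signature of nominals and \(\Sigma^{r} = (S^{r},F^{r},P^{r}) \subseteq \Sigma = (S,F,P)\) are many-sorted first-order signatures; symbols in \(\Sigma^{r}\) are rigid, the others (\(F^{f}, P^{f}\)) flexible. A \(\Delta\)-model is \((W,M)\) with \(W\) a \(\Sigma^{n}\)-model, \(|W|\) the carrier of \(\star\) (worlds), and \(M=\{M_w\}_{w\in|W|}\) \(\Sigma\)-models interpreting all rigid symbols identically. A \(\Delta\)-homomorphism \((W,M)\to(W',M')\) is a \(\Sigma^{n}\)-homomorphism \(h\colon W\to W'\) with \(\Sigma\)-homomorphisms \(h_w\colon M_w\to M'_{h(w)}\) coinciding on rigid sorts. An initial model of \(\Gamma\) is a \(\Delta\)-model satisfying \(\Gamma\) with exactly one homomorphism into every \(\Delta\)-model of \(\Gamma\); reachable means every world is the value of a ground nominal term and every local element the value of a hybrid term. Hybrid terms \(T^{\Delta}_k\) at a ground nominal term \(k\): least family with \(\sigma(t)\in T^{\Delta}_{k,s}\) for rigid \(\sigma\in F^{r}_{ar\to s}\), \(\sigma(k,t) \in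 T^{\Delta}_{k,s}\) for flexible \(\sigma\), \(t \in T^{\Delta}_{k,ar}\), and \(T^{\Delta}_{k_0,s}\subseteq T^{\Delta}_{k,s}\) for rigid sorts \(s\). \(W_k\) is the value of \(k\), \((W,M)_t\in M_{W_k}\) the value of \(t \in T^{\Delta}_k\). Atomic sentences, with world-independent satisfaction: \(k_1 = k_2\) (\(W_{k_1}=W_{k_2}\)); \(\lambda(k)\), \(\lambda\in P^n\) (\(W_k\in W_\lambda\)); \(t_1 =_k t_2\), \(t_i\in T^{\Delta}_{k,s}\) (\((W,M)_{t_1}=(W,M)_{t_2}\)); \(\varpi(t)\), \(\varpi\in P^{r}\), \(t\in T^{\Delta}_{k,ar}\) (\((W,M)_t\in M_{w,\varpi}\)); \(\pi(k,t)\), \(\pi \in P^{f}\) (\((W,M)_t\in M_{W_k,\pi}\)). Actions over \(\Sigma^n\): \(\mathfrak{a} ::= \lambda \mid \mathfrak{a};\mathfrak{a} \mid \mathfrak{a}+\mathfrak{a} \mid \mathfrak{a}^{*}\) with \(\lambda\in P^{n}_{\star\star}\), interpreted in \(W\) as binary relations by relational composition, union and reflexive–transitive closure. An action relation is \(\mathfrak{a}(k_1,k_2)\) for ground nominal terms \(k_i\); it holds iff \((W_{k_1},W_{k_2}) \in W_{\mathfrak{a}}\). \((W,M)\models\rho\) means satisfaction at every world; \(\Gamma \models \rho\) means every \(\Delta\)-model satisfying \(\Gamma\) satisfies \(\rho\). -}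

module Defs where

open import Data.Nat using (ℕ)
open import Data.List using (List; []; _∷_)
open import Data.List.Relation.Unary.All as All using (All; []; _∷_)
open import Data.Vec as Vec using (Vec; []; _∷_)
open import Data.Sum using (_⊎_; inj₁; inj₂)
open import Data.Product using (Σ; _×_; _,_; ∃)
open import Relation.Binary.PropositionalEquality using (_≡_; subst)
open import Relation.Binary.Construct.Closure.ReflexiveTransitive using (Star)
open import Function.Bundles using (_⇔_)

-- Sorts of Σ are  SortR ⊎ SortF  (rigid sorts Sʳ = inj₁ SortR, flexible
-- sorts = inj₂ SortF).  Function / predicate symbols of Σ are split into
-- the rigid ones (those of the subsignature Σʳ, whose arities and sorts
-- are rigid) and the flexible ones (arbitrary arities over S).
-- Σⁿ is one-sorted: symbols are indexed by their arity (a number).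

record Sig : Set₁ where
  field
    FunN  : ℕ → Set
    PredN : ℕ → Set
    SortR : Set
    SortF : Set
    FunR  : List SortR → SortR → Set
    FunF  : List (SortR ⊎ SortF) → SortR ⊎ SortF → Set
    PredR : List SortR → Set
    PredF : List (SortR ⊎ SortF) → Set

  Sort : Set
  Sort = SortR ⊎ SortF

Car : {W SR SF : Set} → (SR → Set) → (W → SF → Set) → W → SR ⊎ SF → Set
Car R F w (inj₁ s) = R s
Car R F w (inj₂ s) = F w s

-- Δ-models (W, M): W a Σⁿ-model, M_w Σ-models sharing the interpretation
-- of all rigid symbols (rigid carriers, rigid functions, rigid predicates).

record Model (Δ : Sig) : Set₁ where
  open Sig Δ
  field
    World : Set
    funN  : ∀ {n} → FunN n → Vec World n → World
    predN : ∀ {n} → PredN n → Vec World n → Set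
    RCar  : SortR → Set
    FCar  : World → SortF → Set
    funR  : ∀ {ar s} → FunR ar s → All RCar ar → RCar s
    predR : ∀ {ar} → PredR ar → All RCar ar → Set
    funF  : ∀ (w : World) {ar s} → FunF ar s → All (Car RCar FCar w) ar → Car RCar FCar w s
    predF : ∀ (w : World) {ar} → PredF ar → All (Car RCar FCar w) ar → Set

  Carrier : World → Sort → Set
  Carrier = Car RCar FCar

hCar : {W W' SR SF : Set} {R R' : SR → Set} {F : W → SF → Set} {F' : W' → SF → Set}
       (hW : W → W') (hR : ∀ {s} → R s → R' s) (hF : ∀ w {s} → F w s → F' (hW w) s)
       (w : W) (s : SR ⊎ SF) → Car R F w s → Car R' F' (hW w) s
hCar hW hR hF w (inj₁ s) x = hR x
hCar hW hR hF w (inj₂ s) x = hF w x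

record Hom {Δ : Sig} (A B : Model Δ) : Set where
  open Sig Δ
  module A = Model A
  module B = Model B
  field
    hW     : A.World → B.World
    hW-fun : ∀ {n} (f : FunN n) (ws : Vec A.World n) →
             hW (A.funN f ws) ≡ B.funN f (Vec.map hW ws)
    hW-pred : ∀ {n} (p : PredN n) (ws : Vec A.World n) →
              A.predN p ws → B.predN p (Vec.map hW ws)
    hR     : ∀ {s} → A.RCar s → B.RCar s
    hF     : ∀ w {s} → A.FCar w s → B.FCar (hW w) s
    hR-fun : ∀ {ar s} (σ : FunR ar s) (xs : All A.RCar ar) →
             hR (A.funR σ xs) ≡ B.funR σ (All.map hR xs)
    hR-pred : ∀ {ar} (ϖ : PredR ar) (xs : All A.RCar ar) →
              A.predR ϖ xs → B.predR ϖ (All.map hR xs)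
    hF-fun : ∀ w {ar s} (σ : FunF ar s) (xs : All (A.Carrier w) ar) →
               hCar {R = A.RCar} {R' = B.RCar} {F = A.FCar} {F' = B.FCar} hW hR hF w s (A.funF w σ xs) ≡ B.funF (hW w) σ
               (All.map (λ {t} → hCar {R = A.RCar} {R' = B.RCar} {F = A.FCar} {F' = B.FCar} hW hR hF w t) xs)
    hF-pred : ∀ w {ar} (π : PredF ar) (xs : All (A.Carrier w) ar) →
              A.predF w π xs → B.predF (hW w) π
               (All.map (λ {t} → hCar {R = A.RCar} {R' = B.RCar} {F = A.FCar} {F' = B.FCar} hW hR hF w t) xs)

_≈Hom_ : {Δ : Sig} {A B : Model Δ} → Hom A B → Hom A B → Set
_≈Hom_ {Δ} {A} {B} h h' =
  Σ (∀ w → Hom.hW h w ≡ Hom.hW h' w) λ eW →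
  (∀ s (x : Model.RCar A s) → Hom.hR h x ≡ Hom.hR h' x) ×
  (∀ w s (x : Model.FCar A w s) →
     subst (λ v → Model.FCar B v s) (eW w) (Hom.hF h w x) ≡ Hom.hF h' w x)

module _ (Δ : Sig) where
  open Sig Δ

  data NTerm : Set where
    app : ∀ {n} → FunN n → Vec NTerm n → NTerm

  mutual
    data Tm (k : NTerm) : Sort → Set where
      rapp  : ∀ {ar s} → FunR ar s → ArgsR k ar → Tm k (inj₁ s)
      fapp  : ∀ {ar s} → FunF ar s → Args k ar → Tm k s
      -- T^Δ_{k₀,s} ⊆ T^Δ_{k,s} for rigid sorts s
      shift : ∀ {s} (k₀ : NTerm) → Tm k₀ (inj₁ s) → Tm k (inj₁ s)

    data ArgsR (k : NTerm) : List SortR → Set where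
      []  : ArgsR k []
      _∷_ : ∀ {s ar} → Tm k (inj₁ s) → ArgsR k ar → ArgsR k (s ∷ ar)

    data Args (k : NTerm) : List Sort → Set where
      []  : Args k []
      _∷_ : ∀ {s ar} → Tm k s → Args k ar → Args k (s ∷ ar)

  data Atom : Set where
    nomEq   : NTerm → NTerm → Atom
    nomPred : ∀ {n} → PredN n → Vec NTerm n → Atom
    tmEq    : ∀ (k : NTerm) {s} → Tm k s → Tm k s → Atom
    rPred   : ∀ {ar} → PredR ar → (k : NTerm) → ArgsR k ar → Atom
    fPred   : ∀ {ar} → PredF ar → (k : NTerm) → Args k ar → Atom

  data Action : Set where
    base : PredN 2 → Action
    _⨾_  : Action → Action → Action
    _⊕_  : Action → Action → Action
    _⋆   : Action → Action

  data Query : Set where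
    atom : Atom → Query
    act  : Action → NTerm → NTerm → Query

module _ {Δ : Sig} (A : Model Δ) where
  open Sig Δ
  open Model A

  mutual
    evalN : NTerm Δ → World
    evalN (app f ks) = funN f (evalNs ks)

    evalNs : ∀ {n} → Vec (NTerm Δ) n → Vec World n
    evalNs []       = []
    evalNs (k ∷ ks) = evalN k ∷ evalNs ks

  mutual
    evalT : ∀ {k s} → Tm Δ k s → Carrier (evalN k) s
    evalT (rapp σ ts)  = funR σ (evalArgsR ts)
    evalT {k} (fapp σ ts) = funF (evalN k) σ (evalArgs ts)
    evalT (shift k₀ t) = evalT t

    evalArgsR : ∀ {k ar} → ArgsR Δ k ar → All RCar ar
    evalArgsR []       = []
    evalArgsR (t ∷ ts) = evalT t ∷ evalArgsR ts

    evalArgs : ∀ {k ar} → Args Δ k ar → All (Carrier (evalN k)) ar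
    evalArgs []       = []
    evalArgs (t ∷ ts) = evalT t ∷ evalArgs ts

  ⟦_⟧ : Action Δ → World → World → Set
  ⟦ base λ' ⟧ x y = predN λ' (x ∷ y ∷ [])
  ⟦ a ⨾ b ⟧   x y = ∃ λ z → ⟦ a ⟧ x z × ⟦ b ⟧ z y
  ⟦ a ⊕ b ⟧   x y = ⟦ a ⟧ x y ⊎ ⟦ b ⟧ x y
  ⟦ a ⋆ ⟧     x y = Star ⟦ a ⟧ x y

  -- satisfaction (world-independent)
  _⊨A_ : Atom Δ → Set
  _⊨A_ (nomEq k₁ k₂)     = evalN k₁ ≡ evalN k₂
  _⊨A_ (nomPred λ' ks)   = predN λ' (evalNs ks)
  _⊨A_ (tmEq k t₁ t₂)    = evalT t₁ ≡ evalT t₂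
  _⊨A_ (rPred ϖ k ts)    = predR ϖ (evalArgsR ts)
  _⊨A_ (fPred π k ts)    = predF (evalN k) π (evalArgs ts)

  _⊨_ : Query Δ → Set
  _⊨_ (atom ρ)      = _⊨A_ ρ
  _⊨_ (act a k₁ k₂) = ⟦ a ⟧ (evalN k₁) (evalN k₂)

  Sat : (Atom Δ → Set) → Set
  Sat Γ = ∀ ρ → Γ ρ → _⊨A_ ρ

  Reachable : Set
  Reachable =
    (∀ (w : World) → ∃ λ (k : NTerm Δ) → evalN k ≡ w) ×
    (∀ (w : World) (s : Sort) (x : Carrier w s) →
       Σ (NTerm Δ) λ k → Σ (evalN k ≡ w) λ e → Σ (Tm Δ k s) λ t →
         subst (λ v → Carrier v s) e (evalT t) ≡ x)

_⊨ₛ_ : {Δ : Sig} → (Atom Δ → Set) → Query Δ → Set₁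
_⊨ₛ_ {Δ} Γ ρ = ∀ (B : Model Δ) → Sat B Γ → _⊨_ B ρ

Initial : {Δ : Sig} → (Atom Δ → Set) → Model Δ → Set₁
Initial {Δ} Γ I =
  Sat I Γ ×
  (∀ (B : Model Δ) → Sat B Γ → Σ (Hom I B) λ h → ∀ (h' : Hom I B) → h' ≈Hom h)

{-# OPTIONS --safe #-}
module Submission where

open import Defs
open import Function.Bundles using (_⇔_; mk⇔)
open import Data.List using ([]; _∷_)
open import Data.List.Relation.Unary.All as All using (All; []; _∷_)
open import Data.Vec as Vec using (Vec; []; _∷_)
open import Data.Sum using (inj₁; inj₂)
open import Data.Product using (_,_; proj₁)
open import Relation.Binary.PropositionalEquality
open import Relation.Binary.PropositionalEquality.Properties using (subst-application′)
import Relation.Binary.Construct.Closure.ReflexiveTransitive as Star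

-- Γ ⊨ ρ is tested in particular on the initial model itself; conversely,
-- the homomorphism from the initial model into any model of Γ carries
-- every atomic sentence and action relation along, because homomorphisms
-- commute with the evaluation of nominal and hybrid terms.

module HomPreservation {Δ : Sig} {A B : Model Δ} (h : Hom A B) where
  open Sig Δ
  open Hom h
  private
    module MA = Model A
    module MB = Model B

  h-carrier : ∀ w s → MA.Carrier w s → MB.Carrier (hW w) s
  h-carrier = hCar {R = MA.RCar} {R' = MB.RCar} {F = MA.FCar} {F' = MB.FCar} hW hR hF

  transport : ∀ {v v'} s → v ≡ v' → MB.Carrier v s → MB.Carrier v' s
  transport s = subst (λ v → MB.Carrier v s)

  transportAll : ∀ {v v'} ar → v ≡ v' → All (MB.Carrier v) ar → All (MB.Carrier v') ar
  transportAll ar = subst (λ v → All (MB.Carrier v) ar)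

  transport-rigid : ∀ {v v'} s (e : v ≡ v') (x : MB.RCar s) → transport (inj₁ s) e x ≡ x
  transport-rigid s refl x = refl

  transportAll-[] : ∀ {v v'} (e : v ≡ v') → transportAll [] e [] ≡ []
  transportAll-[] refl = refl

  transportAll-∷ : ∀ {v v' s ar} (e : v ≡ v') (x : MB.Carrier v s) (xs : All (MB.Carrier v) ar) →
                   transportAll (s ∷ ar) e (x ∷ xs) ≡ transport s e x ∷ transportAll ar e xs
  transportAll-∷ refl x xs = refl

  transport-predF : ∀ {v v' ar} (π : PredF ar) (e : v ≡ v') (xs : All (MB.Carrier v) ar) →
                    MB.predF v π xs → MB.predF v' π (transportAll ar e xs)
  transport-predF π refl xs p = p

  mutual
    hW-evalN : ∀ k → hW (evalN A k) ≡ evalN B k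
    hW-evalN (app f ks) = trans (hW-fun f (evalNs A ks)) (cong (MB.funN f) (hW-evalNs ks))

    hW-evalNs : ∀ {n} (ks : Vec (NTerm Δ) n) → Vec.map hW (evalNs A ks) ≡ evalNs B ks
    hW-evalNs []       = refl
    hW-evalNs (k ∷ ks) = cong₂ _∷_ (hW-evalN k) (hW-evalNs ks)

  mutual
    h-evalT : ∀ {k s} (t : Tm Δ k s) →
              transport s (hW-evalN k) (h-carrier (evalN A k) s (evalT A t)) ≡ evalT B t
    h-evalT {k} {inj₁ s} (rapp σ ts) = begin
      transport (inj₁ s) (hW-evalN k) (hR (MA.funR σ (evalArgsR A ts)))
        ≡⟨ transport-rigid s (hW-evalN k) _ ⟩
      hR (MA.funR σ (evalArgsR A ts))
        ≡⟨ hR-fun σ (evalArgsR A ts) ⟩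
      MB.funR σ (All.map hR (evalArgsR A ts))
        ≡⟨ cong (MB.funR σ) (hR-evalArgsR ts) ⟩
      MB.funR σ (evalArgsR B ts) ∎
      where open ≡-Reasoning
    h-evalT {k} {s} (fapp {ar} σ ts) = begin
      transport s (hW-evalN k) (h-carrier w s (MA.funF w σ (evalArgs A ts)))
        ≡⟨ cong (transport s (hW-evalN k)) (hF-fun w σ (evalArgs A ts)) ⟩
      transport s (hW-evalN k) (MB.funF (hW w) σ (All.map (λ {t} → h-carrier w t) (evalArgs A ts)))
        ≡⟨ subst-application′ (λ v → All (MB.Carrier v) ar) (λ v → MB.funF v σ) (hW-evalN k) ⟩
      MB.funF (evalN B k) σ (transportAll ar (hW-evalN k) (All.map (λ {t} → h-carrier w t) (evalArgs A ts)))
        ≡⟨ cong (MB.funF (evalN B k) σ) (h-evalArgs ts) ⟩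
      MB.funF (evalN B k) σ (evalArgs B ts) ∎
      where
        open ≡-Reasoning
        w = evalN A k
    h-evalT {k} {inj₁ s} (shift k₀ t) = trans (transport-rigid s (hW-evalN k) _) (hR-evalT t)

    hR-evalT : ∀ {k s} (t : Tm Δ k (inj₁ s)) → hR (evalT A t) ≡ evalT B t
    hR-evalT {k} {s} t = trans (sym (transport-rigid s (hW-evalN k) _)) (h-evalT t)

    hR-evalArgsR : ∀ {k ar} (ts : ArgsR Δ k ar) → All.map hR (evalArgsR A ts) ≡ evalArgsR B ts
    hR-evalArgsR []       = refl
    hR-evalArgsR (t ∷ ts) = cong₂ _∷_ (hR-evalT t) (hR-evalArgsR ts)

    h-evalArgs : ∀ {k ar} (ts : Args Δ k ar) →
                 transportAll ar (hW-evalN k) (All.map (λ {t} → h-carrier (evalN A k) t) (evalArgs A ts))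
                   ≡ evalArgs B ts
    h-evalArgs {k} []       = transportAll-[] (hW-evalN k)
    h-evalArgs {k} (t ∷ ts) =
      trans (transportAll-∷ (hW-evalN k) _ _) (cong₂ _∷_ (h-evalT t) (h-evalArgs ts))

  hW-⟦⟧ : ∀ (a : Action Δ) {x y} → ⟦_⟧ A a x y → ⟦_⟧ B a (hW x) (hW y)
  hW-⟦⟧ (base l) p          = hW-pred l _ p
  hW-⟦⟧ (a ⨾ b) (z , p , q) = hW z , hW-⟦⟧ a p , hW-⟦⟧ b q
  hW-⟦⟧ (a ⊕ b) (inj₁ p)    = inj₁ (hW-⟦⟧ a p)
  hW-⟦⟧ (a ⊕ b) (inj₂ p)    = inj₂ (hW-⟦⟧ b p)
  hW-⟦⟧ (a ⋆) p             = Star.gmap hW (hW-⟦⟧ a) p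

  preserves-⊨A : ∀ ρ → _⊨A_ A ρ → _⊨A_ B ρ
  preserves-⊨A (nomEq k₁ k₂) p =
    trans (sym (hW-evalN k₁)) (trans (cong hW p) (hW-evalN k₂))
  preserves-⊨A (nomPred l ks) p = subst (MB.predN l) (hW-evalNs ks) (hW-pred l _ p)
  preserves-⊨A (tmEq k {s} t₁ t₂) p =
    trans (sym (h-evalT t₁))
          (trans (cong (λ x → transport s (hW-evalN k) (h-carrier (evalN A k) s x)) p)
                 (h-evalT t₂))
  preserves-⊨A (rPred ϖ k ts) p = subst (MB.predR ϖ) (hR-evalArgsR ts) (hR-pred ϖ _ p)
  preserves-⊨A (fPred π k ts) p =
    subst (MB.predF (evalN B k) π) (h-evalArgs ts)
          (transport-predF π (hW-evalN k) _ (hF-pred (evalN A k) π _ p))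

  preserves-⊨ : ∀ ρ → _⊨_ A ρ → _⊨_ B ρ
  preserves-⊨ (atom ρ)      p = preserves-⊨A ρ p
  preserves-⊨ (act a k₁ k₂) p = subst₂ (⟦_⟧ B a) (hW-evalN k₁) (hW-evalN k₂) (hW-⟦⟧ a p)

corollary12 : (Δ : Sig) (Γ : Atom Δ → Set) (I : Model Δ) →
    Reachable I → Initial Γ I →
    (ρ : Query Δ) → (Γ ⊨ₛ ρ) ⇔ (_⊨_ I ρ)
corollary12 Δ Γ I _ (I⊨Γ , initial) ρ = mk⇔ holds-in-I holds-in-models
  where
    holds-in-I : Γ ⊨ₛ ρ → _⊨_ I ρ
    holds-in-I Γ⊨ρ = Γ⊨ρ I I⊨Γ

    holds-in-models : _⊨_ I ρ → Γ ⊨ₛ ρ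
    holds-in-models I⊨ρ B B⊨Γ = HomPreservation.preserves-⊨ (proj₁ (initial B B⊨Γ)) ρ I⊨ρ
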